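{- For each prime power $q$ let $G_q$ be a bipartite graph without $4$-cycles whose two parts are two disjoint copies of $\mathbb{F}_q$ (so each part has $q$ vertices), and suppose $G_q$ has $(1+o(1))q^{3/2}$ edges as $q \to \infty$. Let \[ X'_q = \{ \langle (1, x, x^2, x^3, y, y^2, y^3)\rangle : x, y \in \mathbb{F}_q,\ \{x,y\} \text{ is an edge of } G_q \text{ (with } x \text{ in the first part and } y \text{ in the second)} \} \subseteq \mathrm{PG}(6,q). \] Then $|X'_q| = (1+o(1))q^{3/2}$ and $X'_q$ is a $(3,2)$-set, i.e. no plane of $\mathrm{PG}(6,q)$ contains more than $3$ points of $X'_q$.
   Context: $\mathrm{PG}(6,q)$ is the projective space whose points are the $1$-dimensional subspaces of $\mathbb{F}_q^{7}$; a plane is a $3$-dimensional vector subspace. A $(3,2)$-set is a set of points meeting every plane in at most $3$ points. -}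

module Defs where

open import Level using (0ℓ)
open import Data.Nat using (ℕ; suc; _^_; _≤_; _≥_) renaming (_*_ to _*ℕ_)
open import Data.Nat.Primality using (Prime)
open import Data.Fin as Fin using (Fin)
import Data.Product
import Data.List
open import Data.List as List using ()
import Function.Bundles
open import Data.Product using (Σ; ∃; ∃-syntax; _×_; _,_)
open import Data.List using (List; length; filter; concatMap; map)
open import Data.List.Relation.Unary.All using (All)
open import Data.List.Relation.Unary.Any using (Any)
open import Data.List.Relation.Unary.AllPairs using (AllPairs)
open import Relation.Nullary using (¬_; Dec)
open import Relation.Unary using (Decidable)
open import Relation.Binary.PropositionalEquality using (_≡_; _≢_)
open import Algebra.Structures using (IsCommutativeRing)
open import Function.Bundles using (_↔_)

IsPrimePower : ℕ → Set
IsPrimePower q = Σ ℕ λ p → Σ ℕ λ k → Prime p × k ≥ 1 × q ≡ p ^ k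

record FiniteField (q : ℕ) : Set₁ where
  infixl 7 _*_
  infixl 6 _+_
  field
    F     : Set
    _+_   : F → F → F
    _*_   : F → F → F
    -_    : F → F
    0#    : F
    1#    : F
    isCommutativeRing : IsCommutativeRing _≡_ _+_ _*_ -_ 0# 1#
    0≢1   : 0# ≢ 1#
    inv   : ∀ (x : F) → x ≢ 0# → Σ F λ y → x * y ≡ 1#
    enum  : Fin q ↔ F

module _ {q : ℕ} (𝔽 : FiniteField q) where
  open FiniteField 𝔽

  V7 : Set
  V7 = Fin 7 → F

  zeroV : V7
  zeroV _ = 0#

  SamePoint : V7 → V7 → Set
  SamePoint v w = Σ F λ c → c ≢ 0# × (∀ i → v i ≡ c * w i)

  record Plane : Set where
    field
      u₁ u₂ u₃ : V7
      indep : ∀ (a b c : F) →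
              (∀ i → (a * u₁ i + b * u₂ i) + c * u₃ i ≡ 0#) →
              a ≡ 0# × b ≡ 0# × c ≡ 0#

  OnPlane : Plane → V7 → Set
  OnPlane π v = Σ F λ a → Σ F λ b → Σ F λ c →
                  ∀ i → v i ≡ (a * Plane.u₁ π i + b * Plane.u₂ π i) + c * Plane.u₃ π i

  -- bipartite graph whose two parts are two disjoint copies of F_q:
  -- Edge x y means x (first copy) is adjacent to y (second copy)
  record BipGraph : Set₁ where
    field
      Edge  : F → F → Set
      Edge? : ∀ x y → Dec (Edge x y)

  C4Free : BipGraph → Set
  C4Free G = ∀ x₁ x₂ y₁ y₂ → x₁ ≢ x₂ → y₁ ≢ y₂ →
             ¬ (Edge x₁ y₁ × Edge x₁ y₂ × Edge x₂ y₁ × Edge x₂ y₂)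
    where open BipGraph G

  elems : List F
  elems = Data.List.map (Function.Bundles.Inverse.to enum) (Data.List.allFin q)

  numEdges : BipGraph → ℕ
  numEdges G = length (filter (λ p → Edge? (Data.Product.proj₁ p) (Data.Product.proj₂ p))
                              (Data.List.cartesianProduct elems elems))
    where open BipGraph G

  vec : F → F → V7
  vec x y Fin.zero = 1#
  vec x y (Fin.suc Fin.zero) = x
  vec x y (Fin.suc (Fin.suc Fin.zero)) = x * x
  vec x y (Fin.suc (Fin.suc (Fin.suc Fin.zero))) = x * x * x
  vec x y (Fin.suc (Fin.suc (Fin.suc (Fin.suc Fin.zero)))) = y
  vec x y (Fin.suc (Fin.suc (Fin.suc (Fin.suc (Fin.suc Fin.zero))))) = y * y
  vec x y (Fin.suc (Fin.suc (Fin.suc (Fin.suc (Fin.suc (Fin.suc Fin.zero)))))) = y * y * y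

  InX' : BipGraph → V7 → Set
  InX' G v = Σ F λ x → Σ F λ y → BipGraph.Edge G x y × SamePoint v (vec x y)

  HasSize : BipGraph → ℕ → Set
  HasSize G n = Σ (List V7) λ ps →
      length ps ≡ n
    × All (InX' G) ps
    × AllPairs (λ v w → ¬ SamePoint v w) ps
    × (∀ v → InX' G v → Any (SamePoint v) ps)

  Is32Set : BipGraph → Set
  Is32Set G = ∀ (π : Plane) (v₁ v₂ v₃ v₄ : V7) →
      InX' G v₁ → InX' G v₂ → InX' G v₃ → InX' G v₄ →
      AllPairs (λ v w → ¬ SamePoint v w) (v₁ List.∷ v₂ List.∷ v₃ List.∷ v₄ List.∷ List.[]) →
      ¬ (OnPlane π v₁ × OnPlane π v₂ × OnPlane π v₃ × OnPlane π v₄)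

-- n = (1 + O(1/(k+1))) q^{3/2} at precision k, i.e.
-- k/(k+1) ≤ n / q^{3/2} ≤ (k+2)/(k+1), squared to stay in ℕ
Close : ℕ → ℕ → ℕ → Set
Close k q n = (k ^ 2) *ℕ (q ^ 3) ≤ (suc k ^ 2) *ℕ (n ^ 2)
            × (suc k ^ 2) *ℕ (n ^ 2) ≤ (suc (suc k) ^ 2) *ℕ (q ^ 3)

AsympQ32 : (f : (q : ℕ) → IsPrimePower q → ℕ → Set) → Set
AsympQ32 f = ∀ k → ∃[ N ] ∀ q (pp : IsPrimePower q) → q ≥ N → ∀ n → f q pp n → Close k q n

{-# OPTIONS --safe #-}
-- Four points of X′ on a plane satisfy a nontrivial relation
-- ∑ dᵢ (1, xᵢ, xᵢ², xᵢ³, yᵢ, yᵢ², yᵢ³) = 0, since four vectors in a 3-dimensional space are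
-- dependent. Read coordinatewise, the weights dᵢ have vanishing moments of orders 0‥3 at the nodes
-- xᵢ and at the nodes yᵢ, so by interpolation every index with dᵢ ≠ 0 shares its x-value, and also
-- its y-value, with another such index. For four distinct edges this closes a 4-cycle.
-- The size statement holds because (x, y) ↦ ⟨(1, x, x², x³, y, y², y³)⟩ is injective, so the
-- edge list enumerates X′, and any two enumerations have the same length.
module Submission where

open import Level using (0ℓ)
open import Defs
open import Data.Nat using (ℕ; zero; suc; _≤_; _<_; z≤n; s≤s) renaming (_+_ to _+ℕ_)
open import Data.Nat.Properties using (≤-antisym; +-comm; m<n⇒m<1+n)
open import Data.Fin as Fin using (Fin; zero; suc; punchIn)
open import Data.Fin.Patterns using (0F; 1F; 2F; 3F; 4F; 5F; 6F)
open import Data.Fin.Properties using (all?; any?; ¬∀⟶∃¬; punchInᵢ≢i)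
open import Data.Vec.Functional using (insertAt)
open import Data.Vec.Functional.Properties using (insertAt-lookup; insertAt-punchIn)
open import Data.List using (List; []; _∷_; length; lookup; map; filter; cartesianProduct)
open import Data.List.Properties using (length-map)
open import Data.List.Relation.Unary.All as All using (All; []; _∷_; lookupₛ)
open import Data.List.Relation.Unary.All.Properties using (all-filter)
open import Data.List.Relation.Unary.AllPairs using (AllPairs; []; _∷_)
open import Data.List.Relation.Unary.Any using (here; there)
open import Data.List.Membership.Propositional using (_∈_)
open import Data.List.Membership.Propositional.Properties
  using (∈-lookup; ∈-map⁺; ∈-allFin; ∈-filter⁺; ∈-cartesianProduct⁺)
import Data.List.Relation.Unary.All.Properties as All
import Data.List.Relation.Unary.AllPairs as AllPairs
import Data.List.Relation.Unary.AllPairs.Properties as AllPairs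
import Data.List.Relation.Unary.Any as Any
import Data.List.Relation.Unary.Any.Properties as Any
import Data.List.Relation.Unary.Unique.Propositional.Properties as Unique
open import Data.List.Fresh as List# using (fromList)
import Data.List.Fresh.Relation.Unary.Any as Any#
open import Data.Product using (Σ; _×_; _,_; proj₁; proj₂; ∃-syntax; uncurry; map₂)
open import Data.Product.Properties using (×-≡,≡→≡)
open import Data.Sum using (_⊎_; inj₁; inj₂; [_,_])
open import Data.Empty using (⊥; ⊥-elim)
open import Function using (id; _∘_)
open import Function.Bundles using (Injection; Inverse)
open import Function.Properties.Inverse using (↔⇒↣; ↔-sym)
open import Relation.Binary.Bundles using (Setoid)
open import Relation.Binary.Definitions using (Symmetric; DecidableEquality; _Respects_)
open import Relation.Binary.PropositionalEquality
  using (_≡_; _≢_; refl; sym; trans; cong; cong₂; subst; subst₂; module ≡-Reasoning)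
open import Relation.Nullary using (¬_; yes; no; ¬?)
open import Relation.Nullary.Decidable using (_→-dec_; _×-dec_; from-yes; via-injection)
open import Relation.Unary using (Pred; Decidable)
open import Algebra.Bundles using (CommutativeRing; Semiring)
import Algebra.Definitions.RawSemiring as RawSemiringDefinitions
import Algebra.Properties.Ring as RingProperties
import Algebra.Properties.Semiring.Sum as SumProperties
import Algebra.Solver.Ring.NaturalCoefficients.Default as Solver

AllPairs-lookup : ∀ {a r} {A : Set a} {R : A → A → Set r} → Symmetric R → ∀ {xs} → AllPairs R xs →
                  ∀ {i j} → i ≢ j → R (lookup xs i) (lookup xs j)
AllPairs-lookup R-sym (_   ∷ _)   {zero}  {zero}  0≢0 = ⊥-elim (0≢0 refl)
AllPairs-lookup R-sym (xRs ∷ _)   {zero}  {suc j} _   = All.lookup xRs (∈-lookup j)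
AllPairs-lookup R-sym (xRs ∷ _)   {suc i} {zero}  _   = R-sym (All.lookup xRs (∈-lookup i))
AllPairs-lookup R-sym (_   ∷ Rxs) {suc i} {suc j} i≢j = AllPairs-lookup R-sym Rxs (i≢j ∘ cong suc)

module _ {c ℓ} (S : Setoid c ℓ) where
  open Setoid S using (_≈_; _≉_) renaming (Carrier to A)
  open import Data.List.Membership.Setoid S using () renaming (_∈_ to _∈ₛ_)
  open import Data.List.Fresh.Membership.Setoid S using () renaming (_∈_ to _∈#_)
  open import Data.List.Fresh.Membership.Setoid.Properties S using (injection)

  private
    length-fromList : ∀ {xs} (u : AllPairs _≉_ xs) → List#.length (fromList u) ≡ length xs
    length-fromList []      = refl
    length-fromList (_ ∷ u) = cong ℕ.suc (length-fromList u)

    ∈-fromList⁺ : ∀ {x xs} (u : AllPairs _≉_ xs) → x ∈ₛ xs → x ∈# fromList u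
    ∈-fromList⁺ (_ ∷ u) (here x≈y)   = Any#.here x≈y
    ∈-fromList⁺ (_ ∷ u) (there x∈xs) = Any#.there (∈-fromList⁺ u x∈xs)

    ∈-fromList⁻ : ∀ {x xs} (u : AllPairs _≉_ xs) → x ∈# fromList u → x ∈ₛ xs
    ∈-fromList⁻ (_ ∷ u) (Any#.here x≈y)   = here x≈y
    ∈-fromList⁻ (_ ∷ u) (Any#.there x∈xs) = there (∈-fromList⁻ u x∈xs)

  unique-⊆⇒length≤ : ∀ {xs ys} → AllPairs _≉_ xs → AllPairs _≉_ ys →
                     (∀ {x} → x ∈ₛ xs → x ∈ₛ ys) → length xs ≤ length ys
  unique-⊆⇒length≤ u v xs⊆ys = subst₂ _≤_ (length-fromList u) (length-fromList v)
    (injection id (λ x∈xs → ∈-fromList⁺ v (xs⊆ys (∈-fromList⁻ u x∈xs))))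

  Enumerates : ∀ {p} → Pred A p → List A → Set _
  Enumerates P xs = All P xs × AllPairs _≉_ xs × (∀ x → P x → x ∈ₛ xs)

  enumerations-same-length : ∀ {p} {P : Pred A p} → P Respects _≈_ → ∀ {xs ys} →
                             Enumerates P xs → Enumerates P ys → length xs ≡ length ys
  enumerations-same-length resp (Pxs , u , covers-xs) (Pys , v , covers-ys) =
    ≤-antisym (unique-⊆⇒length≤ u v (λ x∈xs → covers-ys _ (lookupₛ S resp Pxs x∈xs)))
              (unique-⊆⇒length≤ v u (λ y∈ys → covers-xs _ (lookupₛ S resp Pys y∈ys)))

fifth-of-Fin4 : ∀ (i j k l m : Fin 4) → i ≢ j → i ≢ k → i ≢ l → j ≢ k → j ≢ l → k ≢ l →
                m ≢ i → m ≢ j → m ≢ k → m ≡ l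
fifth-of-Fin4 = from-yes (all? λ (i : Fin 4) → all? λ j → all? λ k → all? λ l → all? λ m →
  ¬? (i Fin.≟ j) →-dec ¬? (i Fin.≟ k) →-dec ¬? (i Fin.≟ l) →-dec
  ¬? (j Fin.≟ k) →-dec ¬? (j Fin.≟ l) →-dec ¬? (k Fin.≟ l) →-dec
  ¬? (m Fin.≟ i) →-dec ¬? (m Fin.≟ j) →-dec ¬? (m Fin.≟ k) →-dec m Fin.≟ l)

Paired : ∀ {n a s} {A : Set a} → (Fin n → A) → Pred (Fin n) s → Set _
Paired z S = ∀ i → S i → ∃[ j ] j ≢ i × z j ≡ z i × S j

module _ {a b ℓ} {A : Set a} {B : Set b} (E : A → B → Set ℓ)
  (c4-free : ∀ x₁ x₂ y₁ y₂ → x₁ ≢ x₂ → y₁ ≢ y₂ → ¬ (E x₁ y₁ × E x₁ y₂ × E x₂ y₁ × E x₂ y₂))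
  where

  paired-support-empty : ∀ {s} (x : Fin 4 → A) (y : Fin 4 → B) (S : Pred (Fin 4) s) →
    (∀ i → E (x i) (y i)) → (∀ i j → x i ≡ x j → y i ≡ y j → i ≡ j) →
    Paired x S → Paired y S → ∀ i → ¬ S i
  paired-support-empty x y S edge xy-injective x-paired y-paired i Sᵢ
    with j , j≢i , xⱼ≡xᵢ , Sⱼ ← x-paired i Sᵢ
       | k , k≢i , yₖ≡yᵢ , Sₖ ← y-paired i Sᵢ
    with l , l≢k , xₗ≡xₖ , _ ← x-paired k Sₖ
       | m , m≢j , yₘ≡yⱼ , _ ← y-paired j Sⱼ
    = c4-free (x i) (x k) (y i) (y j) xᵢ≢xₖ yᵢ≢yⱼ
        (edge i , subst (λ a → E a (y j)) xⱼ≡xᵢ (edge j) , subst (E (x k)) yₖ≡yᵢ (edge k) ,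
         subst₂ E xₗ≡xₖ (trans (cong y (sym m≡l)) yₘ≡yⱼ) (edge l))
    where
    -- The x-partner l of k and the y-partner m of j avoid i, j, k, so they coincide and
    -- x i, x k, y i, y j span a 4-cycle.
    yᵢ≢yⱼ : y i ≢ y j
    yᵢ≢yⱼ yᵢ≡yⱼ = j≢i (sym (xy-injective i j (sym xⱼ≡xᵢ) yᵢ≡yⱼ))
    xᵢ≢xₖ : x i ≢ x k
    xᵢ≢xₖ xᵢ≡xₖ = k≢i (sym (xy-injective i k xᵢ≡xₖ (sym yₖ≡yᵢ)))
    m≡l : m ≡ l
    m≡l = fifth-of-Fin4 i j k l m
      (j≢i ∘ sym) (k≢i ∘ sym) (λ i≡l → xᵢ≢xₖ (trans (cong x i≡l) xₗ≡xₖ))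
      (λ j≡k → xᵢ≢xₖ (trans (sym xⱼ≡xᵢ) (cong x j≡k)))
      (λ j≡l → xᵢ≢xₖ (trans (sym xⱼ≡xᵢ) (trans (cong x j≡l) xₗ≡xₖ))) (l≢k ∘ sym)
      (λ m≡i → yᵢ≢yⱼ (trans (cong y (sym m≡i)) yₘ≡yⱼ)) m≢j
      (λ m≡k → yᵢ≢yⱼ (trans (sym yₖ≡yᵢ) (trans (cong y (sym m≡k)) yₘ≡yⱼ)))

module _ {q : ℕ} (𝔽 : FiniteField q) where
  open FiniteField 𝔽

  commutativeRing : CommutativeRing 0ℓ 0ℓ
  commutativeRing = record { isCommutativeRing = isCommutativeRing }

  open CommutativeRing commutativeRing
    using ( ring; semiring; commutativeSemiring; zeroˡ; zeroʳ; *-assoc; *-comm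
          ; +-identityˡ; +-identityʳ; *-identityˡ; *-identityʳ; -‿inverseˡ)
  open RawSemiringDefinitions (Semiring.rawSemiring semiring) using (_^_; product)
  open RingProperties ring using (-1*x≈-x)
  open SumProperties semiring
    using (sum-syntax; sum-remove; sum-cong-≗; ∑-distrib-+; *-distribˡ-sum; *-distribʳ-sum; ∑-comm; sum-replicate-zero)
  open Solver commutativeSemiring using (solve; _:+_; _:*_; _:=_; con)
  open ≡-Reasoning

  _≟_ : DecidableEquality F
  _≟_ = via-injection (↔⇒↣ (↔-sym enum)) Fin._≟_

  1≢0 : 1# ≢ 0#
  1≢0 1≡0 = 0≢1 (sym 1≡0)

  *-cancelˡ : ∀ {a b c} → a ≢ 0# → a * b ≡ a * c → b ≡ c
  *-cancelˡ {a} {b} {c} a≢0 ab≡ac with a⁻¹ , aa⁻¹≡1 ← inv a a≢0 = begin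
    b              ≡⟨ solve 1 (λ b → b := con 1 :* b) refl b ⟩
    1# * b         ≡⟨ cong (_* b) aa⁻¹≡1 ⟨
    a * a⁻¹ * b    ≡⟨ solve 3 (λ a a⁻¹ b → a :* a⁻¹ :* b := a⁻¹ :* (a :* b)) refl a a⁻¹ b ⟩
    a⁻¹ * (a * b)  ≡⟨ cong (a⁻¹ *_) ab≡ac ⟩
    a⁻¹ * (a * c)  ≡⟨ solve 3 (λ a a⁻¹ c → a⁻¹ :* (a :* c) := a :* a⁻¹ :* c) refl a a⁻¹ c ⟩
    a * a⁻¹ * c    ≡⟨ cong (_* c) aa⁻¹≡1 ⟩
    1# * c         ≡⟨ solve 1 (λ c → con 1 :* c := c) refl c ⟩
    c              ∎

  *-nonzero : ∀ {a b} → a ≢ 0# → b ≢ 0# → a * b ≢ 0#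
  *-nonzero {a} {b} a≢0 b≢0 ab≡0 = b≢0 (*-cancelˡ a≢0 (trans ab≡0 (sym (zeroʳ a))))

  -- Negation only enters as multiplication by -1#, so that the commutative-semiring solver applies.
  -1# : F
  -1# = - 1#

  -1#*x+x≡0 : ∀ x → -1# * x + x ≡ 0#
  -1#*x+x≡0 x = trans (cong (_+ x) (-1*x≈-x x)) (-‿inverseˡ x)

  ∑-combination : ∀ {n} a b (f g : Fin n → F) →
                  ∑[ i < n ] (a * f i + b * g i) ≡ a * ∑[ i < n ] f i + b * ∑[ i < n ] g i
  ∑-combination a b f g =
    trans (∑-distrib-+ (λ i → a * f i) (λ i → b * g i))
          (cong₂ _+_ (sym (*-distribˡ-sum a f)) (sym (*-distribˡ-sum b g)))

  ∑-zero : ∀ {n} (f : Fin n → F) → (∀ i → f i ≡ 0#) → ∑[ i < n ] f i ≡ 0#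
  ∑-zero {n} f f≡0 = trans (sum-cong-≗ f≡0) (sum-replicate-zero n)

  Dependence : ∀ {n m} → (Fin n → Fin m → F) → Set
  Dependence {n} {m} w = Σ (Fin n → F) λ e → (∃[ i ] e i ≢ 0#) × (∀ t → ∑[ i < n ] (e i * w i t) ≡ 0#)

  private
    extend-by-zero-column : ∀ {m} (w : Fin (suc (suc m)) → Fin (suc m) → F) → (∀ i → w i zero ≡ 0#) →
                            Dependence (λ i t → w (suc i) (suc t)) → Dependence w
    extend-by-zero-column w column-zero (e′ , (i , e′ᵢ≢0) , e′-rel) =
      insertAt e′ zero 0# , (suc i , e′ᵢ≢0) , λ where
        zero    → trans (cong₂ _+_ (zeroˡ (w zero zero)) (∑-zero (λ j → e′ j * w (suc j) zero) e′ⱼ*0≡0))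
                        (+-identityˡ 0#)
        (suc t) → trans (cong₂ _+_ (zeroˡ (w zero (suc t))) (e′-rel t)) (+-identityˡ 0#)
      where
      e′ⱼ*0≡0 : ∀ j → e′ j * w (suc j) zero ≡ 0#
      e′ⱼ*0≡0 j = trans (cong (e′ j *_) (column-zero (suc j))) (zeroʳ (e′ j))

    -- Clears coordinate 0 of every other vector against the pivot vector w p.
    Reduced : ∀ {m} → (Fin (suc (suc m)) → Fin (suc m) → F) → Fin (suc (suc m)) → Fin (suc m) → Fin m → F
    Reduced w p j t = w p zero * w (punchIn p j) (suc t) + -1# * (w (punchIn p j) zero * w p (suc t))

    eliminate-pivot : ∀ {m} (w : Fin (suc (suc m)) → Fin (suc m) → F) p → w p zero ≢ 0# →
                      Dependence (Reduced w p) → Dependence w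
    eliminate-pivot {m} w p π≢0 (e′ , (i , e′ᵢ≢0) , e′-rel) = e , (punchIn p i , eᵢ≢0) , e-rel
      where
      π : F
      π = w p zero
      B : F
      B = ∑[ j < suc m ] (e′ j * w (punchIn p j) zero)
      e″ : Fin (suc m) → F
      e″ j = π * e′ j
      e : Fin (suc (suc m)) → F
      e = insertAt e″ p (-1# * B)

      eᵢ≢0 : e (punchIn p i) ≢ 0#
      eᵢ≢0 rewrite insertAt-punchIn e″ p (-1# * B) i = *-nonzero π≢0 e′ᵢ≢0

      split : ∀ t → ∑[ k < suc (suc m) ] (e k * w k t)
                    ≡ -1# * B * w p t + π * ∑[ j < suc m ] (e′ j * w (punchIn p j) t)
      split t = begin
        ∑[ k < suc (suc m) ] (e k * w k t)
          ≡⟨ sum-remove {i = p} (λ k → e k * w k t) ⟩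
        e p * w p t + ∑[ j < suc m ] (e (punchIn p j) * w (punchIn p j) t)
          ≡⟨ cong₂ _+_ (cong (_* w p t) (insertAt-lookup e″ p (-1# * B)))
                       (sum-cong-≗ λ j → trans (cong (_* w (punchIn p j) t) (insertAt-punchIn e″ p (-1# * B) j))
                                               (*-assoc π (e′ j) (w (punchIn p j) t))) ⟩
        -1# * B * w p t + ∑[ j < suc m ] (π * (e′ j * w (punchIn p j) t))
          ≡⟨ cong (-1# * B * w p t +_) (*-distribˡ-sum π (λ j → e′ j * w (punchIn p j) t)) ⟨
        -1# * B * w p t + π * ∑[ j < suc m ] (e′ j * w (punchIn p j) t)
          ∎

      e-rel : ∀ t → ∑[ k < suc (suc m) ] (e k * w k t) ≡ 0#
      e-rel zero = begin
        _                     ≡⟨ split zero ⟩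
        -1# * B * π + π * B   ≡⟨ solve 3 (λ m b p → m :* b :* p :+ p :* b := p :* (m :* b :+ b)) refl -1# B π ⟩
        π * (-1# * B + B)     ≡⟨ cong (π *_) (-1#*x+x≡0 B) ⟩
        π * 0#                ≡⟨ zeroʳ π ⟩
        0#                    ∎
      e-rel (suc t) = begin
        _                                        ≡⟨ split (suc t) ⟩
        -1# * B * W + π * ∑[ j < suc m ] a j     ≡⟨ solve 4 (λ m b w a → m :* b :* w :+ a := a :+ m :* (b :* w))
                                                           refl -1# B W (π * ∑[ j < suc m ] a j) ⟩
        π * ∑[ j < suc m ] a j + -1# * (B * W)   ≡⟨ cong (λ s → π * ∑[ j < suc m ] a j + -1# * s) (*-distribʳ-sum W b) ⟩
        π * ∑[ j < suc m ] a j + -1# * ∑[ j < suc m ] (b j * W)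
                                                 ≡⟨ ∑-combination π -1# a (λ j → b j * W) ⟨
        ∑[ j < suc m ] (π * a j + -1# * (b j * W))
                                                 ≡⟨ sum-cong-≗ (λ j → solve 6 (λ e p a m b w →
                                                      p :* (e :* a) :+ m :* (e :* b :* w) := e :* (p :* a :+ m :* (b :* w)))
                                                      refl (e′ j) π (w (punchIn p j) (suc t)) -1# (w (punchIn p j) zero) W) ⟩
        ∑[ j < suc m ] (e′ j * Reduced w p j t)  ≡⟨ e′-rel t ⟩
        0#                                       ∎
        where
        W : F
        W = w p (suc t)
        a b : Fin (suc m) → F
        a j = e′ j * w (punchIn p j) (suc t)
        b j = e′ j * w (punchIn p j) zero

  dependence : ∀ m (w : Fin (suc m) → Fin m → F) → Dependence w
  dependence zero    w = (λ _ → 1#) , (zero , 1≢0) , λ ()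
  dependence (suc m) w with all? (λ i → w i zero ≟ 0#)
  ... | yes column-zero = extend-by-zero-column w column-zero (dependence m (λ i t → w (suc i) (suc t)))
  ... | no ¬column-zero with p , π≢0 ← ¬∀⟶∃¬ _ _ (λ i → w i zero ≟ 0#) ¬column-zero =
    eliminate-pivot w p π≢0 (dependence m (Reduced w p))

  dependence-transfers : ∀ {n m} (e : Fin n → F) (w : Fin n → Fin m → F) →
                         (∀ c → ∑[ i < n ] (e i * w i c) ≡ 0#) →
                         ∀ (u : Fin m → F) → ∑[ i < n ] (e i * ∑[ c < m ] (w i c * u c)) ≡ 0#
  dependence-transfers {n} {m} e w e-rel u = begin
    ∑[ i < n ] (e i * ∑[ c < m ] (w i c * u c))
      ≡⟨ sum-cong-≗ (λ i → *-distribˡ-sum (e i) (λ c → w i c * u c)) ⟩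
    ∑[ i < n ] (∑[ c < m ] (e i * (w i c * u c)))
      ≡⟨ ∑-comm (λ i c → e i * (w i c * u c)) ⟩
    ∑[ c < m ] (∑[ i < n ] (e i * (w i c * u c)))
      ≡⟨ sum-cong-≗ (λ c → trans (sum-cong-≗ λ i → sym (*-assoc (e i) (w i c) (u c)))
                                 (sym (*-distribʳ-sum (u c) (λ i → e i * w i c)))) ⟩
    ∑[ c < m ] (∑[ i < n ] (e i * w i c) * u c)
      ≡⟨ ∑-zero _ (λ c → trans (cong (_* u c) (e-rel c)) (zeroˡ (u c))) ⟩
    0# ∎

  moment : ∀ {n} → (Fin n → F) → (Fin n → F) → ℕ → F
  moment {n} z d k = ∑[ j < n ] (d j * z j ^ k)

  MomentsVanish : ∀ {n} → ℕ → (Fin n → F) → (Fin n → F) → Set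
  MomentsVanish r z d = ∀ k → k < r → moment z d k ≡ 0#

  private
    moment-cong : ∀ {n} (z : Fin n → F) {d d′ : Fin n → F} → (∀ j → d j ≡ d′ j) →
                  ∀ k → moment z d k ≡ moment z d′ k
    moment-cong z d≗d′ k = sum-cong-≗ λ j → cong (_* z j ^ k) (d≗d′ j)

    moment-*-linear : ∀ {n} (z d : Fin n → F) a b k →
      moment z (λ j → d j * (a + b * z j)) k ≡ a * moment z d k + b * moment z d (suc k)
    moment-*-linear z d a b k = trans
      (sum-cong-≗ λ j → solve 5 (λ d a b z zᵏ → d :* (a :+ b :* z) :* zᵏ := a :* (d :* zᵏ) :+ b :* (d :* (z :* zᵏ)))
                                 refl (d j) a b (z j) (z j ^ k))
      (∑-combination a b (λ j → d j * z j ^ k) (λ j → d j * z j ^ suc k))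

  moments-*-linear : ∀ {n r} (z d : Fin n → F) a b → MomentsVanish (suc r) z d →
                     MomentsVanish r z (λ j → d j * (a + b * z j))
  moments-*-linear z d a b vanish k k<r = begin
    moment z (λ j → d j * (a + b * z j)) k       ≡⟨ moment-*-linear z d a b k ⟩
    a * moment z d k + b * moment z d (suc k)   ≡⟨ cong₂ (λ m m′ → a * m + b * m′)
                                                         (vanish k (m<n⇒m<1+n k<r)) (vanish (suc k) (s≤s k<r)) ⟩
    a * 0# + b * 0#                             ≡⟨ solve 2 (λ a b → a :* con 0 :+ b :* con 0 := con 0) refl a b ⟩
    0#                                          ∎

  moments-*-product : ∀ {n} r {s} (z d : Fin n → F) (a b : Fin r → F) → MomentsVanish (r +ℕ s) z d →
                      MomentsVanish s z (λ j → d j * product (λ l → a l + b l * z j))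
  moments-*-product zero z d a b vanish k k<s =
    trans (moment-cong z (λ j → *-identityʳ (d j)) k) (vanish k k<s)
  moments-*-product (suc r) z d a b vanish k k<s = trans
    (moment-cong z (λ j → sym (*-assoc (d j) _ _)) k)
    (moments-*-product r z (λ j → d j * (a zero + b zero * z j)) (a ∘ suc) (b ∘ suc)
      (moments-*-linear z d (a zero) (b zero) vanish) k k<s)

  product-zero : ∀ {n} (f : Fin n → F) i → f i ≡ 0# → product f ≡ 0#
  product-zero f zero    fᵢ≡0 = trans (cong (_* product (f ∘ suc)) fᵢ≡0) (zeroˡ _)
  product-zero f (suc i) fᵢ≡0 = trans (cong (f zero *_) (product-zero (f ∘ suc) i fᵢ≡0)) (zeroʳ _)

  product-nonzero : ∀ {n} (f : Fin n → F) → (∀ i → f i ≢ 0#) → product f ≢ 0#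
  product-nonzero {zero}  f _   = 1≢0
  product-nonzero {suc n} f f≢0 = *-nonzero (f≢0 zero) (product-nonzero (f ∘ suc) (f≢0 ∘ suc))

  -1#*x+y≡0⇒x≡y : ∀ x y → -1# * x + y ≡ 0# → x ≡ y
  -1#*x+y≡0⇒x≡y x y -x+y≡0 = begin
    x                    ≡⟨ solve 1 (λ x → x := con 0 :+ x) refl x ⟩
    0# + x               ≡⟨ cong (_+ x) -x+y≡0 ⟨
    -1# * x + y + x      ≡⟨ solve 3 (λ m x y → m :* x :+ y :+ x := (m :* x :+ x) :+ y) refl -1# x y ⟩
    (-1# * x + x) + y    ≡⟨ cong (_+ y) (-1#*x+x≡0 x) ⟩
    0# + y               ≡⟨ +-identityˡ y ⟩
    y                    ∎

  isolated-weight-zero : ∀ {n} (z d : Fin (suc n) → F) → MomentsVanish (suc n) z d → ∀ i →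
                         (∀ j → z (punchIn i j) ≢ z i ⊎ d (punchIn i j) ≡ 0#) → d i ≡ 0#
  isolated-weight-zero {n} z d vanish i separated =
    *-cancelˡ (product-nonzero (λ l → factor l (z i)) factor-nonzero-at-i)
              (trans (*-comm _ (d i)) (trans dᵢPᵢ≡0 (sym (zeroʳ _))))
    where
    -- P has degree ≤ n, vanishes at each z j with j ≠ i and d j ≠ 0, but not at z i; the vanishing
    -- moments give ∑ d j P (z j) = 0, in which only the term d i P (z i) survives.
    a b : Fin n → F
    a l = [ (λ _ → -1# * z (punchIn i l)) , (λ _ → 1#) ] (separated l)
    b l = [ (λ _ → 1#) , (λ _ → 0#) ] (separated l)

    factor : Fin n → F → F
    factor l t = a l + b l * t

    P : F → F
    P t = product (λ l → factor l t)

    factor-nonzero-at-i : ∀ l → factor l (z i) ≢ 0#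
    factor-nonzero-at-i l with separated l
    ... | inj₁ zₗ≢zᵢ = λ f≡0 →
      zₗ≢zᵢ (-1#*x+y≡0⇒x≡y _ _ (trans (cong (-1# * z (punchIn i l) +_) (sym (*-identityˡ (z i)))) f≡0))
    ... | inj₂ _     = λ f≡0 → 1≢0 (trans (sym (trans (cong (1# +_) (zeroˡ (z i))) (+-identityʳ 1#))) f≡0)

    factor-vanishes-at-own-node : ∀ l → factor l (z (punchIn i l)) ≡ 0# ⊎ d (punchIn i l) ≡ 0#
    factor-vanishes-at-own-node l with separated l
    ... | inj₁ _   = inj₁ (trans (cong (-1# * z (punchIn i l) +_) (*-identityˡ _)) (-1#*x+x≡0 _))
    ... | inj₂ d≡0 = inj₂ d≡0

    other-terms-vanish : ∀ l → d (punchIn i l) * P (z (punchIn i l)) * 1# ≡ 0#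
    other-terms-vanish l with factor-vanishes-at-own-node l
    ... | inj₁ f≡0 = trans (cong (λ p → d (punchIn i l) * p * 1#)
                                 (product-zero (λ l′ → factor l′ (z (punchIn i l))) l f≡0))
                           (solve 1 (λ x → x :* con 0 :* con 1 := con 0) refl _)
    ... | inj₂ d≡0 = trans (cong (λ x → x * P (z (punchIn i l)) * 1#) d≡0)
                           (solve 1 (λ x → con 0 :* x :* con 1 := con 0) refl _)

    dᵢPᵢ≡0 : d i * P (z i) ≡ 0#
    dᵢPᵢ≡0 = begin
      d i * P (z i)
        ≡⟨ solve 1 (λ x → x := x :* con 1 :+ con 0) refl _ ⟩
      d i * P (z i) * 1# + 0#
        ≡⟨ cong (d i * P (z i) * 1# +_) (∑-zero _ other-terms-vanish) ⟨
      d i * P (z i) * 1# + ∑[ l < n ] (d (punchIn i l) * P (z (punchIn i l)) * 1#)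
        ≡⟨ sum-remove {i = i} (λ j → d j * P (z j) * 1#) ⟨
      moment z (λ j → d j * P (z j)) 0
        ≡⟨ moments-*-product n z d a b (subst (λ r → MomentsVanish r z d) (+-comm 1 n) vanish) 0 (s≤s z≤n) ⟩
      0# ∎

  weights-paired : ∀ {n} (z d : Fin (suc n) → F) → MomentsVanish (suc n) z d → Paired z (λ i → d i ≢ 0#)
  weights-paired z d vanish i dᵢ≢0
    with any? (λ j → (z (punchIn i j) ≟ z i) ×-dec ¬? (d (punchIn i j) ≟ 0#))
  ... | yes (j , zⱼ≡zᵢ , dⱼ≢0) = punchIn i j , punchInᵢ≢i i j , zⱼ≡zᵢ , dⱼ≢0
  ... | no ¬paired = ⊥-elim (dᵢ≢0 (isolated-weight-zero z d vanish i separated))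
    where
    separated : ∀ j → z (punchIn i j) ≢ z i ⊎ d (punchIn i j) ≡ 0#
    separated j with z (punchIn i j) ≟ z i | d (punchIn i j) ≟ 0#
    ... | no zⱼ≢zᵢ  | _        = inj₁ zⱼ≢zᵢ
    ... | yes _     | yes dⱼ≡0 = inj₂ dⱼ≡0
    ... | yes zⱼ≡zᵢ | no dⱼ≢0  = ⊥-elim (¬paired (j , zⱼ≡zᵢ , dⱼ≢0))

  samePoint-refl : ∀ {v} → SamePoint 𝔽 v v
  samePoint-refl {v} = 1# , 1≢0 , λ t → sym (*-identityˡ (v t))

  samePoint-sym : ∀ {v w} → SamePoint 𝔽 v w → SamePoint 𝔽 w v
  samePoint-sym {v} {w} (c , c≢0 , v≡cw) with c⁻¹ , cc⁻¹≡1 ← inv c c≢0 =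
    c⁻¹ , c⁻¹≢0 , λ t → *-cancelˡ c≢0 (trans (sym (v≡cw t)) (sym (c*[c⁻¹*x]≡x (v t))))
    where
    c⁻¹≢0 : c⁻¹ ≢ 0#
    c⁻¹≢0 c⁻¹≡0 = 0≢1 (trans (sym (zeroʳ c)) (trans (cong (c *_) (sym c⁻¹≡0)) cc⁻¹≡1))
    c*[c⁻¹*x]≡x : ∀ x → c * (c⁻¹ * x) ≡ x
    c*[c⁻¹*x]≡x x = trans (sym (*-assoc c c⁻¹ x)) (trans (cong (_* x) cc⁻¹≡1) (*-identityˡ x))

  samePoint-trans : ∀ {u v w} → SamePoint 𝔽 u v → SamePoint 𝔽 v w → SamePoint 𝔽 u w
  samePoint-trans (c , c≢0 , u≡cv) (c′ , c′≢0 , v≡c′w) =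
    c * c′ , *-nonzero c≢0 c′≢0 , λ t → trans (u≡cv t) (trans (cong (c *_) (v≡c′w t)) (sym (*-assoc c c′ _)))

  pointSetoid : Setoid 0ℓ 0ℓ
  pointSetoid = record
    { _≈_           = SamePoint 𝔽
    ; isEquivalence = record { refl = samePoint-refl ; sym = samePoint-sym ; trans = samePoint-trans }
    }

  vec-injective : ∀ {x y x′ y′} → SamePoint 𝔽 (vec 𝔽 x y) (vec 𝔽 x′ y′) → x ≡ x′ × y ≡ y′
  vec-injective (c , _ , vec≡c·vec′) = scaled-by-one (vec≡c·vec′ 1F) , scaled-by-one (vec≡c·vec′ 4F)
    where
    c≡1 : c ≡ 1#
    c≡1 = trans (sym (*-identityʳ c)) (sym (vec≡c·vec′ 0F))
    scaled-by-one : ∀ {a b} → a ≡ c * b → a ≡ b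
    scaled-by-one a≡cb = trans a≡cb (trans (cong (_* _) c≡1) (*-identityˡ _))

  vec-relation⇒moments : ∀ {n} (x y d : Fin n → F) → (∀ t → ∑[ i < n ] (d i * vec 𝔽 (x i) (y i) t) ≡ 0#) →
                         MomentsVanish 4 x d × MomentsVanish 4 y d
  vec-relation⇒moments {n} x y d relation =
    moments-from x 1F 2F 3F (λ _ → refl) (λ _ → refl) (λ _ → refl) ,
    moments-from y 4F 5F 6F (λ _ → refl) (λ _ → refl) (λ _ → refl)
    where
    from-coordinate : ∀ (z : Fin n → F) t k → (∀ i → vec 𝔽 (x i) (y i) t ≡ z i ^ k) → moment z d k ≡ 0#
    from-coordinate z t k vecₜ≡zᵏ = trans (sum-cong-≗ λ i → cong (d i *_) (sym (vecₜ≡zᵏ i))) (relation t)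

    moments-from : ∀ (z : Fin n → F) t₁ t₂ t₃ →
      (∀ i → vec 𝔽 (x i) (y i) t₁ ≡ z i) → (∀ i → vec 𝔽 (x i) (y i) t₂ ≡ z i * z i) →
      (∀ i → vec 𝔽 (x i) (y i) t₃ ≡ z i * z i * z i) → MomentsVanish 4 z d
    moments-from z t₁ t₂ t₃ vec₁ vec₂ vec₃ = λ where
      0 _ → from-coordinate z 0F 0 (λ _ → refl)
      1 _ → from-coordinate z t₁ 1 (λ i → trans (vec₁ i) (solve 1 (λ a → a := a :* con 1) refl (z i)))
      2 _ → from-coordinate z t₂ 2 (λ i → trans (vec₂ i) (solve 1 (λ a → a :* a := a :* (a :* con 1)) refl (z i)))
      3 _ → from-coordinate z t₃ 3
              (λ i → trans (vec₃ i) (solve 1 (λ a → a :* a :* a := a :* (a :* (a :* con 1))) refl (z i)))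
      (suc (suc (suc (suc _)))) (s≤s (s≤s (s≤s (s≤s ()))))

  basis : Plane 𝔽 → Fin 3 → V7 𝔽
  basis π 0F = Plane.u₁ π
  basis π 1F = Plane.u₂ π
  basis π 2F = Plane.u₃ π

  OnPlane⇒combination : ∀ π {v} → OnPlane 𝔽 π v →
                        Σ (Fin 3 → F) λ w → ∀ t → v t ≡ ∑[ c < 3 ] (w c * basis π c t)
  OnPlane⇒combination π (a , b , c , v≡abc) = coefficients , λ t → trans (v≡abc t)
    (solve 6 (λ a b c u₁ u₂ u₃ → a :* u₁ :+ b :* u₂ :+ c :* u₃ := a :* u₁ :+ (b :* u₂ :+ (c :* u₃ :+ con 0)))
           refl a b c (Plane.u₁ π t) (Plane.u₂ π t) (Plane.u₃ π t))
    where
    coefficients : Fin 3 → F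
    coefficients 0F = a
    coefficients 1F = b
    coefficients 2F = c

  open Inverse enum using (to; from; strictlyInverseˡ)

  ∈-elems : ∀ x → x ∈ elems 𝔽
  ∈-elems x = subst (_∈ elems 𝔽) (strictlyInverseˡ x) (∈-map⁺ to (∈-allFin (from x)))

  elems-unique : AllPairs _≢_ (elems 𝔽)
  elems-unique = Unique.map⁺ (Injection.injective (↔⇒↣ enum)) (Unique.allFin⁺ q)

  module _ (G : BipGraph 𝔽) where
    open BipGraph G

    edge? : Decidable (uncurry Edge)
    edge? (x , y) = Edge? x y

    edges : List (F × F)
    edges = filter edge? (cartesianProduct (elems 𝔽) (elems 𝔽))

    edges-unique : AllPairs _≢_ edges
    edges-unique = Unique.filter⁺ edge? (Unique.cartesianProduct⁺ elems-unique elems-unique)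

    ∈-edges : ∀ {x y} → Edge x y → (x , y) ∈ edges
    ∈-edges {x} {y} = ∈-filter⁺ edge? (∈-cartesianProduct⁺ (∈-elems x) (∈-elems y))

    edgePoints : List (V7 𝔽)
    edgePoints = map (uncurry (vec 𝔽)) edges

    InX′-respects : InX' 𝔽 G Respects SamePoint 𝔽
    InX′-respects v≈w (x , y , xy , v≈vec) = x , y , xy , samePoint-trans (samePoint-sym v≈w) v≈vec

    edgePoints-enumerate : Enumerates pointSetoid (InX' 𝔽 G) edgePoints
    edgePoints-enumerate =
      All.gmap⁺ (λ {(x , y)} xy → x , y , xy , samePoint-refl) (all-filter edge? (cartesianProduct (elems 𝔽) (elems 𝔽))) ,
      AllPairs.map⁺ (AllPairs.map (λ p≢p′ same → p≢p′ (×-≡,≡→≡ (vec-injective same))) edges-unique) ,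
      λ v (x , y , xy , v≈vec) → Any.map⁺ (Any.map (λ { refl → v≈vec }) (∈-edges xy))

    HasSize-numEdges : HasSize 𝔽 G (numEdges 𝔽 G)
    HasSize-numEdges = edgePoints , length-map (uncurry (vec 𝔽)) edges , edgePoints-enumerate

    HasSize⇒≡numEdges : ∀ {n} → HasSize 𝔽 G n → n ≡ numEdges 𝔽 G
    HasSize⇒≡numEdges {n} (ps , length≡n , ps-enumerate) = begin
      n                 ≡⟨ length≡n ⟨
      length ps         ≡⟨ enumerations-same-length pointSetoid InX′-respects ps-enumerate edgePoints-enumerate ⟩
      length edgePoints ≡⟨ length-map (uncurry (vec 𝔽)) edges ⟩
      numEdges 𝔽 G      ∎

    edge-vectors-independent : C4Free 𝔽 G → (x y d : Fin 4 → F) → (∀ i → Edge (x i) (y i)) →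
      (∀ i j → x i ≡ x j → y i ≡ y j → i ≡ j) →
      (∀ t → ∑[ i < 4 ] (d i * vec 𝔽 (x i) (y i) t) ≡ 0#) → ∀ i → ¬ d i ≢ 0#
    edge-vectors-independent c4-free x y d edge xy-injective relation =
      paired-support-empty Edge c4-free x y (λ i → d i ≢ 0#) edge xy-injective
        (weights-paired x d x-moments) (weights-paired y d y-moments)
      where
      x-moments : MomentsVanish 4 x d
      x-moments = proj₁ (vec-relation⇒moments x y d relation)
      y-moments : MomentsVanish 4 y d
      y-moments = proj₂ (vec-relation⇒moments x y d relation)

    four-coplanar-points-impossible : C4Free 𝔽 G → (π : Plane 𝔽) (v : Fin 4 → V7 𝔽) →
      (∀ i → InX' 𝔽 G (v i)) → (∀ i → OnPlane 𝔽 π (v i)) →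
      (∀ i j → SamePoint 𝔽 (v i) (v j) → i ≡ j) → ⊥
    four-coplanar-points-impossible c4-free π v v∈X v∈π v-injective
      with e , (i₀ , eᵢ₀≢0) , e-rel ← dependence 3 (λ i → proj₁ (OnPlane⇒combination π (v∈π i)))
      = edge-vectors-independent c4-free x y d edge xy-injective relation i₀ (*-nonzero eᵢ₀≢0 (scale≢0 i₀))
      where
      w : Fin 4 → Fin 3 → F
      w i = proj₁ (OnPlane⇒combination π (v∈π i))
      x y scale d : Fin 4 → F
      x i = proj₁ (v∈X i)
      y i = proj₁ (proj₂ (v∈X i))
      edge : ∀ i → Edge (x i) (y i)
      edge i = proj₁ (proj₂ (proj₂ (v∈X i)))
      v≈vec : ∀ i → SamePoint 𝔽 (v i) (vec 𝔽 (x i) (y i))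
      v≈vec i = proj₂ (proj₂ (proj₂ (v∈X i)))
      scale i = proj₁ (v≈vec i)
      scale≢0 : ∀ i → scale i ≢ 0#
      scale≢0 i = proj₁ (proj₂ (v≈vec i))
      d i = e i * scale i

      xy-injective : ∀ i j → x i ≡ x j → y i ≡ y j → i ≡ j
      xy-injective i j xᵢ≡xⱼ yᵢ≡yⱼ = v-injective i j (samePoint-trans (v≈vec i)
        (subst₂ (λ a b → SamePoint 𝔽 (vec 𝔽 a b) (v j)) (sym xᵢ≡xⱼ) (sym yᵢ≡yⱼ) (samePoint-sym (v≈vec j))))

      relation : ∀ t → ∑[ i < 4 ] (d i * vec 𝔽 (x i) (y i) t) ≡ 0#
      relation t = trans
        (sum-cong-≗ λ i → begin
          e i * scale i * vec 𝔽 (x i) (y i) t   ≡⟨ *-assoc (e i) (scale i) _ ⟩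
          e i * (scale i * vec 𝔽 (x i) (y i) t) ≡⟨ cong (e i *_) (proj₂ (proj₂ (v≈vec i)) t) ⟨
          e i * v i t                          ≡⟨ cong (e i *_) (proj₂ (OnPlane⇒combination π (v∈π i)) t) ⟩
          e i * ∑[ c < 3 ] (w i c * basis π c t) ∎)
        (dependence-transfers e w e-rel (λ c → basis π c t))

    edgePoints-32-set : C4Free 𝔽 G → Is32Set 𝔽 G
    edgePoints-32-set c4-free π v₁ v₂ v₃ v₄ v₁∈X v₂∈X v₃∈X v₄∈X distinct
                      (v₁∈π , v₂∈π , v₃∈π , v₄∈π) =
      four-coplanar-points-impossible c4-free π (lookup vs)
        (λ i → All.lookup {P = InX' 𝔽 G} (v₁∈X ∷ v₂∈X ∷ v₃∈X ∷ v₄∈X ∷ []) (∈-lookup i))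
        (λ i → All.lookup {P = OnPlane 𝔽 π} (v₁∈π ∷ v₂∈π ∷ v₃∈π ∷ v₄∈π ∷ []) (∈-lookup i))
        injective
      where
      vs : List (V7 𝔽)
      vs = v₁ ∷ v₂ ∷ v₃ ∷ v₄ ∷ []
      injective : ∀ i j → SamePoint 𝔽 (lookup vs i) (lookup vs j) → i ≡ j
      injective i j same with i Fin.≟ j
      ... | yes i≡j = i≡j
      ... | no i≢j  = ⊥-elim (AllPairs-lookup (λ ¬same → ¬same ∘ samePoint-sym) distinct i≢j same)

theorem9 : (𝔽 : (q : ℕ) → IsPrimePower q → FiniteField q)
    → (G : (q : ℕ) (pp : IsPrimePower q) → BipGraph (𝔽 q pp))
    → (∀ q pp → C4Free (𝔽 q pp) (G q pp))
    → AsympQ32 (λ q pp n → n ≡ numEdges (𝔽 q pp) (G q pp))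
    → ((∀ q pp → ∃[ n ] HasSize (𝔽 q pp) (G q pp) n)
       × AsympQ32 (λ q pp n → HasSize (𝔽 q pp) (G q pp) n))
      × (∀ q pp → Is32Set (𝔽 q pp) (G q pp))
theorem9 𝔽 G c4-free edges-asymptotic =
  ( (λ q pp → numEdges (𝔽 q pp) (G q pp) , HasSize-numEdges (𝔽 q pp) (G q pp))
  , λ k → map₂ (λ close q pp q≥N n size → close q pp q≥N n (HasSize⇒≡numEdges (𝔽 q pp) (G q pp) size))
               (edges-asymptotic k))
  , λ q pp → edgePoints-32-set (𝔽 q pp) (G q pp) (c4-free q pp)
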